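{- Let $n,m\ge 1$ and let $G=K_n+E_m$ be the join of the complete graph $K_n$ on vertex set $\{1,\ldots,n\}$ and the edgeless graph $E_m$ on vertex set $\{n+1,\ldots,n+m\}$ (so $V(G)=\{1,\ldots,n+m\}$, the vertices $1,\ldots,n$ are pairwise adjacent, each of them is adjacent to every vertex of $\{n+1,\ldots,n+m\}$, and there are no other edges). Then the intervals $[A\setminus Int(A);A\cup Ext(A)]$, $A$ ranging over the maximal independent sets of $G$, form a partition of $2^{V(G)}$.
   Context: The labels give the linear order on the vertex set. For an independent set $A$: $Ext(A)=\{u\notin A:\ \exists a\in A,\ a\in N(u),\ u>a\}$; for $u\in A$, $Subs(u)=\{w\in N(u): (A\setminus\{u\})\cup\{w\}\text{ independent}\}$, $u$ is internally active if $Subs(u)=\emptyset$ or $u>\max Subs(u)$; $Int(A)$ is the set of internally active vertices of $A$. $[X;Y]=\{Z: X\subseteq Z\subseteq Y\}$. A family of intervals forms a partition of $2^V$ if the intervals (for distinct maximal independent sets) are pairwise disjoint and their union is $2^V$. -}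

module Defs where

open import Data.Nat using (ℕ; _+_; _<_)
open import Data.Fin using (Fin; toℕ)
open import Data.Fin.Subset using (Subset; _∈_; _∉_; _⊆_; _∪_; _-_; ⁅_⁆)
open import Data.Product using (Σ; _×_; ∃-syntax)
open import Data.Sum using (_⊎_)
open import Relation.Nullary using (¬_)
open import Relation.Binary.PropositionalEquality using (_≡_; _≢_)

-- A graph on the vertex set Fin N, given by its adjacency relation.
-- The linear order on vertices is the order of labels, i.e. toℕ.
Graph : ℕ → Set₁
Graph N = Fin N → Fin N → Set

_<ᵥ_ : ∀ {N} → Fin N → Fin N → Set
u <ᵥ v = toℕ u < toℕ v

module _ {N : ℕ} (E : Graph N) where

  Independent : Subset N → Set
  Independent A = ∀ u v → u ∈ A → v ∈ A → ¬ E u v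

  MaximalIndependent : Subset N → Set
  MaximalIndependent A =
    Independent A × (∀ B → Independent B → A ⊆ B → B ⊆ A)

  InExt : Subset N → Fin N → Set
  InExt A u = u ∉ A × (∃[ a ] (a ∈ A × E u a × a <ᵥ u))

  InSubs : Subset N → Fin N → Fin N → Set
  InSubs A u w = E u w × Independent ((A - u) ∪ ⁅ w ⁆)

  -- u is internally active: Subs(u) = ∅ or u > max Subs(u)
  InternallyActive : Subset N → Fin N → Set
  InternallyActive A u = ∀ w → InSubs A u w → w <ᵥ u

  InInt : Subset N → Fin N → Set
  InInt A u = u ∈ A × InternallyActive A u

  InInterval : Subset N → Subset N → Set
  InInterval A Z =
    (∀ x → x ∈ A → ¬ InInt A x → x ∈ Z) ×
    (∀ x → x ∈ Z → x ∈ A ⊎ InExt A x)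

  IntervalsPartition : Set
  IntervalsPartition =
    (∀ Z → ∃[ A ] (MaximalIndependent A × InInterval A Z)) ×
    (∀ A B Z → MaximalIndependent A → MaximalIndependent B →
       InInterval A Z → InInterval B Z → A ≡ B)

-- The join K_n + E_m on Fin (n + m): vertex i (0-based) has label i+1;
-- vertices with toℕ < n form the clique K_n, the rest the edgeless part.
Join-K-E : (n m : ℕ) → Graph (n + m)
Join-K-E n m u v = u ≢ v × (toℕ u < n ⊎ toℕ v < n)

-- The maximal independent sets of K_n + E_m are the singletons {k} of clique
-- vertices and the edgeless part E. A clique vertex k is never internally
-- active, because an edgeless vertex (m ≥ 1), which has a larger label, can
-- replace it; and every larger vertex is a neighbour of k, hence in Ext({k}).
-- So the interval of {k} consists of the sets whose least element is k.
-- Every edgeless vertex is internally active, its only substitutes being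
-- smaller clique vertices, and Ext(E) is empty, so the interval of E is 2^E.
-- Hence each Z lies in the interval of {min Z} if min Z is a clique vertex,
-- and in that of E otherwise, and in no other.
module Submission where

open import Defs
open import Data.Nat using (ℕ; suc; _+_; _≥_; _≤_; _<_; z≤n; s≤s; _≤?_; _<?_)
open import Data.Nat.Properties using (<⇒≱; ≰⇒>; <-asym; ≤-<-trans; <-≤-trans; <-trans; m≤m+n)
open import Data.Fin using (Fin; zero; suc; toℕ; _↑ʳ_)
open import Data.Fin.Properties using (any?; toℕ-↑ʳ; ≤∧≢⇒<) renaming (_≟_ to _≟ᶠ_)
open import Data.Fin.Subset using (Subset; _∈_; _∉_; _⊆_; _∪_; _-_; _─_; ⁅_⁆; inside; outside)
open import Data.Fin.Subset.Properties using (_∈?_; x∈⁅x⁆; x∈⁅y⁆⇒x≡y; x≢y⇒x∉⁅y⁆; ⊆-antisym; x∈p∪q⁻; p─q⊆p)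
open import Data.Vec using (_∷_; tabulate; here; there)
open import Data.Vec.Properties using ([]=⇒lookup; lookup⇒[]=; lookup∘tabulate)
open import Data.Product using (_×_; _,_; ∃-syntax)
open import Data.Sum using (_⊎_; inj₁; inj₂)
open import Data.Empty using (⊥-elim)
open import Relation.Nullary using (¬_; yes; no; _×-dec_)
open import Relation.Nullary.Decidable using (isYes; toWitness; fromWitness)
open import Data.Bool.Properties using (T-≡)
open import Function.Bundles using (Equivalence)
open import Relation.Binary.PropositionalEquality using (_≡_; _≢_; refl; sym; trans; cong; subst; subst₂)

x∈p─q⇒x∉q : ∀ {N} (p q : Subset N) {x} → x ∈ p ─ q → x ∉ q
x∈p─q⇒x∉q (_ ∷ p) (inside ∷ q) () here
x∈p─q⇒x∉q (_ ∷ p) (_ ∷ q) (there x∈p─q) (there x∈q) = x∈p─q⇒x∉q p q x∈p─q x∈q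

least-element : ∀ {N} (Z : Subset N) {x} → x ∈ Z →
                ∃[ i ] (i ∈ Z × (∀ {j} → j ∈ Z → toℕ i ≤ toℕ j))
least-element (inside ∷ Z) _ = zero , here , λ _ → z≤n
least-element (outside ∷ Z) (there x∈Z) with least-element Z x∈Z
... | i , i∈Z , i-least = suc i , there i∈Z , λ { (there j∈Z) → s≤s (i-least j∈Z) }

module _ {N : ℕ} (E : Graph N) where

  Dominating : Fin N → Set
  Dominating k = ∀ x → x ≢ k → E x k

  ⁅⁆-independent : ∀ {k} → ¬ E k k → Independent E ⁅ k ⁆
  ⁅⁆-independent {k} ¬Ekk u v u∈ v∈ =
    subst₂ (λ a b → ¬ E a b) (sym (x∈⁅y⁆⇒x≡y k u∈)) (sym (x∈⁅y⁆⇒x≡y k v∈)) ¬Ekk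

  independent⊆⁅dominating⁆ : ∀ {A k} → Independent E A → k ∈ A → Dominating k → A ⊆ ⁅ k ⁆
  independent⊆⁅dominating⁆ {k = k} indA k∈A dom {x} x∈A with x ≟ᶠ k
  ... | yes refl = x∈⁅x⁆ x
  ... | no x≢k = ⊥-elim (indA x k x∈A k∈A (dom x x≢k))

  dominating-maximal : ∀ {k} → ¬ E k k → Dominating k → MaximalIndependent E ⁅ k ⁆
  dominating-maximal {k} ¬Ekk dom =
    ⁅⁆-independent ¬Ekk ,
    λ B indB k⊆B → independent⊆⁅dominating⁆ indB (k⊆B (x∈⁅x⁆ k)) dom

  ⁅⁆-subs : ∀ {k w} → E k w → ¬ E w w → InSubs E ⁅ k ⁆ k w
  ⁅⁆-subs {k} {w} Ekw ¬Eww = Ekw , λ u v u∈ v∈ → ⁅⁆-independent ¬Eww u v (only-w u∈) (only-w v∈)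
    where
    only-w : ∀ {x} → x ∈ (⁅ k ⁆ - k) ∪ ⁅ w ⁆ → x ∈ ⁅ w ⁆
    only-w x∈ with x∈p∪q⁻ (⁅ k ⁆ - k) ⁅ w ⁆ x∈
    ... | inj₁ x∈⁅k⁆-k = ⊥-elim (x∈p─q⇒x∉q ⁅ k ⁆ ⁅ k ⁆ x∈⁅k⁆-k (p─q⊆p ⁅ k ⁆ ⁅ k ⁆ x∈⁅k⁆-k))
    ... | inj₂ x∈⁅w⁆ = x∈⁅w⁆

  ⁅⁆-interval-lower : ∀ {k w Z} → E k w → ¬ E w w → k <ᵥ w → InInterval E ⁅ k ⁆ Z → k ∈ Z
  ⁅⁆-interval-lower {k} Ekw ¬Eww k<w (lower , _) =
    lower k (x∈⁅x⁆ k) λ (_ , active) → <-asym k<w (active _ (⁅⁆-subs Ekw ¬Eww))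

  ⁅⁆-interval-upper : ∀ {k Z x} → InInterval E ⁅ k ⁆ Z → x ∈ Z → x ≡ k ⊎ k <ᵥ x
  ⁅⁆-interval-upper {k} (_ , upper) x∈Z with upper _ x∈Z
  ... | inj₁ x∈⁅k⁆ = inj₁ (x∈⁅y⁆⇒x≡y k x∈⁅k⁆)
  ... | inj₂ (_ , a , a∈⁅k⁆ , _ , a<x) = inj₂ (subst (_<ᵥ _) (x∈⁅y⁆⇒x≡y k a∈⁅k⁆) a<x)

  ⁅⁆-interval⁺ : ∀ {k Z} → Dominating k → k ∈ Z → (∀ {x} → x ∈ Z → toℕ k ≤ toℕ x) →
                 InInterval E ⁅ k ⁆ Z
  ⁅⁆-interval⁺ {k} {Z} dom k∈Z k-least = lower , upper
    where
    lower : ∀ x → x ∈ ⁅ k ⁆ → ¬ InInt E ⁅ k ⁆ x → x ∈ Z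
    lower x x∈⁅k⁆ _ = subst (_∈ _) (sym (x∈⁅y⁆⇒x≡y k x∈⁅k⁆)) k∈Z
    upper : ∀ x → x ∈ Z → x ∈ ⁅ k ⁆ ⊎ InExt E ⁅ k ⁆ x
    upper x x∈Z with x ≟ᶠ k
    ... | yes refl = inj₁ (x∈⁅x⁆ k)
    ... | no x≢k = inj₂ (x≢y⇒x∉⁅y⁆ x≢k , k , x∈⁅x⁆ k , dom x x≢k ,
                         ≤∧≢⇒< (k-least x∈Z) (λ k≡x → x≢k (sym k≡x)))

module _ (n m : ℕ) where

  private
    G = Join-K-E n m

  Edgeless : Subset (n + m)
  Edgeless = tabulate (λ i → isYes (n ≤? toℕ i))

  ∈Edgeless⁺ : ∀ {x} → n ≤ toℕ x → x ∈ Edgeless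
  ∈Edgeless⁺ {x} n≤x =
    lookup⇒[]= x Edgeless (trans (lookup∘tabulate _ x) (Equivalence.to T-≡ (fromWitness n≤x)))

  ∈Edgeless⁻ : ∀ {x} → x ∈ Edgeless → n ≤ toℕ x
  ∈Edgeless⁻ {x} x∈ =
    toWitness (Equivalence.from T-≡ (trans (sym (lookup∘tabulate _ x)) ([]=⇒lookup x∈)))

  join-irreflexive : ∀ {k} → ¬ G k k
  join-irreflexive (k≢k , _) = k≢k refl

  clique-dominating : ∀ {k} → toℕ k < n → Dominating G k
  clique-dominating k<n x x≢k = x≢k , inj₂ k<n

  Edgeless-independent : Independent G Edgeless
  Edgeless-independent u v u∈ v∈ (_ , inj₁ u<n) = <⇒≱ u<n (∈Edgeless⁻ u∈)
  Edgeless-independent u v u∈ v∈ (_ , inj₂ v<n) = <⇒≱ v<n (∈Edgeless⁻ v∈)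

  clique-free⇒⊆Edgeless : ∀ {A} → (∀ {x} → x ∈ A → ¬ toℕ x < n) → A ⊆ Edgeless
  clique-free⇒⊆Edgeless noClique {x} x∈A with n ≤? toℕ x
  ... | yes n≤x = ∈Edgeless⁺ n≤x
  ... | no n≰x = ⊥-elim (noClique x∈A (≰⇒> n≰x))

  maximal-independent-cases : ∀ {A} → MaximalIndependent G A →
                              (∃[ k ] (toℕ k < n × A ≡ ⁅ k ⁆)) ⊎ A ≡ Edgeless
  maximal-independent-cases {A} (indA , maxA) with any? (λ k → (toℕ k <? n) ×-dec (k ∈? A))
  ... | yes (k , k<n , k∈A) =
    inj₁ (k , k<n , ⊆-antisym (independent⊆⁅dominating⁆ G indA k∈A (clique-dominating k<n))
                              λ x∈⁅k⁆ → subst (_∈ A) (sym (x∈⁅y⁆⇒x≡y k x∈⁅k⁆)) k∈A)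
  ... | no noClique = inj₂ (⊆-antisym A⊆E (maxA Edgeless Edgeless-independent A⊆E))
    where
    A⊆E : A ⊆ Edgeless
    A⊆E = clique-free⇒⊆Edgeless λ {x} x∈A x<n → noClique (x , x<n , x∈A)

  Edgeless-interval⁺ : ∀ {Z} → Z ⊆ Edgeless → InInterval G Edgeless Z
  Edgeless-interval⁺ Z⊆E = lower , λ x x∈Z → inj₁ (Z⊆E x∈Z)
    where
    lower : ∀ x → x ∈ Edgeless → ¬ InInt G Edgeless x → x ∈ _
    lower x x∈E passive = ⊥-elim (passive (x∈E , active))
      where
      active : InternallyActive G Edgeless x
      active w ((_ , inj₁ x<n) , _) = ⊥-elim (<⇒≱ x<n (∈Edgeless⁻ x∈E))
      active w ((_ , inj₂ w<n) , _) = <-≤-trans w<n (∈Edgeless⁻ x∈E)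

  Edgeless-interval⁻ : ∀ {Z} → InInterval G Edgeless Z → Z ⊆ Edgeless
  Edgeless-interval⁻ (_ , upper) {x} x∈Z with upper x x∈Z
  ... | inj₁ x∈E = x∈E
  ... | inj₂ (_ , a , a∈E , (_ , inj₁ x<n) , a<x) = ⊥-elim (<⇒≱ (<-trans a<x x<n) (∈Edgeless⁻ a∈E))
  ... | inj₂ (_ , a , a∈E , (_ , inj₂ a<n) , _) = ⊥-elim (<⇒≱ a<n (∈Edgeless⁻ a∈E))

  module _ (e : Fin (n + m)) (n≤e : n ≤ toℕ e) where

    Edgeless-maximal : MaximalIndependent G Edgeless
    Edgeless-maximal = Edgeless-independent , maximal
      where
      maximal : ∀ B → Independent G B → Edgeless ⊆ B → B ⊆ Edgeless
      maximal B indB E⊆B = clique-free⇒⊆Edgeless λ {x} x∈B x<n →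
        indB x e x∈B (E⊆B (∈Edgeless⁺ n≤e)) ((λ { refl → <⇒≱ x<n n≤e }) , inj₁ x<n)

    intervals-cover : ∀ Z → ∃[ A ] (MaximalIndependent G A × InInterval G A Z)
    intervals-cover Z with any? (λ k → (toℕ k <? n) ×-dec (k ∈? Z))
    ... | yes (k , k<n , k∈Z) =
      let i , i∈Z , i-least = least-element Z k∈Z
          i-dominating = clique-dominating (≤-<-trans (i-least k∈Z) k<n)
      in ⁅ i ⁆ , dominating-maximal G join-irreflexive i-dominating ,
         ⁅⁆-interval⁺ G i-dominating i∈Z i-least
    ... | no noClique =
      Edgeless , Edgeless-maximal ,
      Edgeless-interval⁺ (clique-free⇒⊆Edgeless λ {x} x∈Z x<n → noClique (x , x<n , x∈Z))

    clique-interval-lower : ∀ {k Z} → toℕ k < n → InInterval G ⁅ k ⁆ Z → k ∈ Z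
    clique-interval-lower k<n =
      ⁅⁆-interval-lower G (k≢e , inj₁ k<n) join-irreflexive (<-≤-trans k<n n≤e)
      where
      k≢e : _ ≢ e
      k≢e k≡e = <⇒≱ k<n (subst (λ v → n ≤ toℕ v) (sym k≡e) n≤e)

    clique-intervals-disjoint : ∀ {k k′ Z} → toℕ k < n → toℕ k′ < n →
                                InInterval G ⁅ k ⁆ Z → InInterval G ⁅ k′ ⁆ Z → k ≡ k′
    clique-intervals-disjoint k<n k′<n Zk Zk′
      with ⁅⁆-interval-upper G Zk (clique-interval-lower k′<n Zk′)
         | ⁅⁆-interval-upper G Zk′ (clique-interval-lower k<n Zk)
    ... | inj₁ k′≡k | _ = sym k′≡k
    ... | inj₂ _ | inj₁ k≡k′ = k≡k′
    ... | inj₂ k<k′ | inj₂ k′<k = ⊥-elim (<-asym k<k′ k′<k)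

    clique-Edgeless-intervals-disjoint : ∀ {k Z} → toℕ k < n →
                                         InInterval G ⁅ k ⁆ Z → ¬ InInterval G Edgeless Z
    clique-Edgeless-intervals-disjoint k<n Zk ZE =
      <⇒≱ k<n (∈Edgeless⁻ (Edgeless-interval⁻ ZE (clique-interval-lower k<n Zk)))

    intervals-disjoint : ∀ A B Z → MaximalIndependent G A → MaximalIndependent G B →
                         InInterval G A Z → InInterval G B Z → A ≡ B
    intervals-disjoint A B Z maxA maxB ZA ZB
      with maximal-independent-cases maxA | maximal-independent-cases maxB
    ... | inj₁ (k , k<n , refl) | inj₁ (k′ , k′<n , refl) =
      cong ⁅_⁆ (clique-intervals-disjoint k<n k′<n ZA ZB)
    ... | inj₁ (k , k<n , refl) | inj₂ refl = ⊥-elim (clique-Edgeless-intervals-disjoint k<n ZA ZB)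
    ... | inj₂ refl | inj₁ (k , k<n , refl) = ⊥-elim (clique-Edgeless-intervals-disjoint k<n ZB ZA)
    ... | inj₂ refl | inj₂ refl = refl

theorem8 : (n m : ℕ) → n ≥ 1 → m ≥ 1 → IntervalsPartition (Join-K-E n m)
theorem8 n (suc m) _ _ = intervals-cover n (suc m) e n≤e , intervals-disjoint n (suc m) e n≤e
  where
  e : Fin (n + suc m)
  e = n ↑ʳ zero
  n≤e : n ≤ toℕ e
  n≤e = subst (n ≤_) (sym (toℕ-↑ʳ n zero)) (m≤m+n n 0)
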